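{- Let $A$ be a finite set with at least two elements, let $e \ge 1$, and let $(B;+)$ be an abelian group of exponent $2^e$. Then for every $n \ge 1$, every function $f \colon A^n \to B$ determined by $\operatorname{oddsupp}$ is $(|A| + e - 2)$-decomposable.
   Context: For a tuple $(a_1,\dots,a_m) \in A^m$, $\operatorname{oddsupp}(a_1,\dots,a_m) = \{a \in A : |\{j : a_j = a\}| \text{ is odd}\}$. A function $f \colon A^n \to B$ is determined by $\operatorname{oddsupp}$ if there is a map $\varphi \colon \mathcal{P}(A) \to B$ with $f(\mathbf{x}) = \varphi(\operatorname{oddsupp}(\mathbf{x}))$ for all $\mathbf{x} \in A^n$. The $i$-th variable of $g \colon A^n \to B$ is essential if there are tuples differing only in the $i$-th coordinate on which $g$ takes different values; the essential arity of $g$ is the number of its essential variables. $f$ is $k$-decomposable if $f = f_1 + \dots + f_s$ for some functions $f_j \colon A^n \to B$ each of essential arity at most $k$. The exponent of $B$ is the least common multiple of the orders of its elements (if these are bounded). -}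

module Defs where

open import Level using (Level)
open import Data.Nat using (ℕ; zero; suc; _≤_; _%_; _≡ᵇ_)
open import Data.Bool using (Bool; if_then_else_)
open import Data.Fin using (Fin)
open import Data.Fin.Properties using (_≟_)
open import Data.Fin.Subset using (Subset; inside; outside; _∈_; ∣_∣)
open import Data.Vec using (Vec; tabulate; count; _[_]≔_)
open import Data.List using (List; foldr)
open import Data.List.Relation.Unary.All using (All)
open import Data.Product using (Σ; _×_; ∃; ∃₂)
open import Relation.Nullary using (¬_)
open import Algebra.Bundles using (AbelianGroup)
import Algebra.Definitions.RawMonoid as RM

-- The finite set A is modelled as Fin k (|A| = k).
-- P(A) is modelled by stdlib's Subset k.

isOdd : ℕ → Bool
isOdd m = (m % 2) ≡ᵇ 1

oddsupp : ∀ {k n} → Vec (Fin k) n → Subset k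
oddsupp x = tabulate λ a → if isOdd (count (_≟ a) x) then inside else outside

module _ {c ℓ : Level} (B : AbelianGroup c ℓ) where
  open AbelianGroup B
  open RM rawMonoid using () renaming (_×_ to _·_)

  HasExponent : ℕ → Set (c Level.⊔ ℓ)
  HasExponent m =
    (1 ≤ m) × (∀ b → (m · b) ≈ ε)
      × (∀ m′ → 1 ≤ m′ → (∀ b → (m′ · b) ≈ ε) → m ≤ m′)

  DeterminedByOddsupp : ∀ {k n} → (Vec (Fin k) n → Carrier) → Set (c Level.⊔ ℓ)
  DeterminedByOddsupp {k} {n} f =
    Σ (Subset k → Carrier) λ φ → ∀ (x : Vec (Fin k) n) → f x ≈ φ (oddsupp x)

  Essential : ∀ {k n} → (Vec (Fin k) n → Carrier) → Fin n → Set ℓ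
  Essential g i = ∃₂ λ x a → ¬ (g x ≈ g (x [ i ]≔ a))

  EssArityAtMost : ∀ {k n} → ℕ → (Vec (Fin k) n → Carrier) → Set ℓ
  EssArityAtMost {k} {n} m g =
    Σ (Subset n) λ S → (∣ S ∣ ≤ m) × (∀ i → Essential g i → i ∈ S)

  Decomposable : ∀ {k n} → ℕ → (Vec (Fin k) n → Carrier) → Set (c Level.⊔ ℓ)
  Decomposable {k} {n} m f =
    Σ (List (Vec (Fin k) n → Carrier)) λ fs →
      All (EssArityAtMost m) fs
        × (∀ x → f x ≈ foldr (λ g acc → g x ∙ acc) ε fs)

module Submission where

open import Defs
open import Level using (Level)
open import Function using (_∘_)
open import Data.Nat using (ℕ; zero; suc; _≤_; _<_; _+_; _∸_; _^_; z≤n; s≤s)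
open import Data.Nat.Properties using (≤-reflexive; ≤-trans; +-suc; +-identityʳ; +-monoˡ-≤)
open import Data.Bool using (Bool; true; false; not; _xor_; if_then_else_)
open import Data.Bool.Properties using (if-eta; not-distribˡ-xor; not-distribʳ-xor; xor-assoc; xor-same; xor-identityʳ)
open import Data.Fin using (Fin; zero; suc)
open import Data.Fin.Properties using (_≟_)
open import Data.Fin.Subset using (Subset; inside; outside; _∈_; _∉_; _─_; ⊤; ⁅_⁆; ∣_∣)
open import Data.Fin.Subset.Properties using (_∈?_; ∈⊤; ∣⊤∣≡n; p─q⊆p; x∈p∧x≢y⇒x∈p-y; x∈p⇒∣p-x∣<∣p∣)
open import Data.Vec using (Vec; []; _∷_; tail; lookup; tabulate; count; _[_]%=_; _[_]≔_; here; there)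
open import Data.Vec.Properties
  using ( lookup∘tabulate; lookup∘updateAt; lookup∘updateAt′
        ; updateAt-commutes; updateAt-updateAt; updateAt-id-local; updateAt-cong-local)
open import Data.Vec.Relation.Binary.Pointwise.Extensional using (ext; Pointwise-≡⇒≡)
open import Data.List using (List; []; _∷_; foldr; _++_; map)
open import Data.List.Relation.Unary.All as All using ([]; _∷_)
open import Data.List.Relation.Unary.All.Properties using (++⁺; map⁺)
open import Data.Product using (_,_)
open import Relation.Nullary using (does; yes; no; contradiction)
open import Relation.Binary.PropositionalEquality using (_≡_; _≢_; refl; sym; trans; cong; cong₂; module ≡-Reasoning)
open import Algebra.Bundles using (AbelianGroup)

-- Write f = ψ ∘ oddsupp and peel off the first variable:
--   ψ (oddsupp (y ∷ x)) = ψ (oddsupp x) + Σₐ [y = a] Δₐψ (oddsupp x),  Δₐψ p = ψ (p △ {a}) − ψ p,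
-- so by induction on n it suffices to decompose each Δₐψ ∘ oddsupp with arity one less.
-- If ψ only depends on the coordinates in R and 2^t annihilates it, then Δₐψ = 0 for a ∉ R,
-- while for a ∈ R it splits into a part depending only on R − {a} and a part annihilated by
-- 2^(t−1); so ψ ∘ oddsupp is (|R| + t − 1)-decomposable. As |oddsupp x| ≡ n (mod 2), the
-- first coordinate of oddsupp x is determined by the others, so |R| = |A| − 1 suffices.

private
  variable
    k n m : ℕ

toggle : Fin k → Subset k → Subset k
toggle a p = p [ a ]%= not

toggle-comm : ∀ (a b : Fin k) p → toggle a (toggle b p) ≡ toggle b (toggle a p)
toggle-comm a b p with a ≟ b
... | yes refl = refl
... | no a≢b = updateAt-commutes a b a≢b p

parity : Subset k → Bool
parity []       = false
parity (b ∷ bs) = b xor parity bs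

parity-toggle : ∀ (a : Fin k) p → parity (toggle a p) ≡ not (parity p)
parity-toggle zero    (b ∷ bs) = sym (not-distribˡ-xor b (parity bs))
parity-toggle (suc a) (b ∷ bs) =
  trans (cong (b xor_) (parity-toggle a bs)) (sym (not-distribʳ-xor b (parity bs)))

fixParity : Bool → Subset (suc k) → Subset (suc k)
fixParity b (_ ∷ bs) = (b xor parity bs) ∷ bs

fixParity-parity : ∀ b (p : Subset (suc k)) → parity p ≡ b → fixParity b p ≡ p
fixParity-parity _ (c ∷ cs) refl = cong (_∷ cs) (begin
  (c xor parity cs) xor parity cs  ≡⟨ xor-assoc c (parity cs) (parity cs) ⟩
  c xor (parity cs xor parity cs)  ≡⟨ cong (c xor_) (xor-same (parity cs)) ⟩
  c xor false                      ≡⟨ xor-identityʳ c ⟩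
  c                                ∎)
  where open ≡-Reasoning

isOdd-suc : ∀ m → isOdd (suc m) ≡ not (isOdd m)
isOdd-suc zero          = refl
isOdd-suc (suc zero)    = refl
isOdd-suc (suc (suc m)) = isOdd-suc m

lookup-oddsupp : ∀ (x : Vec (Fin k) n) a → lookup (oddsupp x) a ≡ isOdd (count (_≟ a) x)
lookup-oddsupp x a = trans (lookup∘tabulate _ a) (if-η (isOdd (count (_≟ a) x)))
  where
  if-η : ∀ b → (if b then true else false) ≡ b
  if-η true  = refl
  if-η false = refl

oddsupp-∷ : ∀ y (x : Vec (Fin k) n) → oddsupp (y ∷ x) ≡ toggle y (oddsupp x)
oddsupp-∷ y x = Pointwise-≡⇒≡ (ext λ a → trans (lookup-oddsupp (y ∷ x) a) (lookup-∷ a))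
  where
  lookup-∷ : ∀ a → isOdd (count (_≟ a) (y ∷ x)) ≡ lookup (toggle y (oddsupp x)) a
  lookup-∷ a with y ≟ a
  ... | yes refl = trans (isOdd-suc (count (_≟ y) x))
                         (sym (trans (lookup∘updateAt y (oddsupp x)) (cong not (lookup-oddsupp x y))))
  ... | no y≢a = sym (trans (lookup∘updateAt′ a y (y≢a ∘ sym) (oddsupp x)) (lookup-oddsupp x a))

parity-oddsupp : ∀ (x : Vec (Fin k) n) → parity (oddsupp x) ≡ isOdd n
parity-oddsupp {k} [] = parity-empty k
  where
  parity-empty : ∀ k → parity (tabulate {n = k} (λ _ → outside)) ≡ false
  parity-empty zero    = refl
  parity-empty (suc k) = parity-empty k
parity-oddsupp {n = suc n} (y ∷ x) = begin
  parity (oddsupp (y ∷ x))         ≡⟨ cong parity (oddsupp-∷ y x) ⟩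
  parity (toggle y (oddsupp x))    ≡⟨ parity-toggle y (oddsupp x) ⟩
  not (parity (oddsupp x))         ≡⟨ cong not (parity-oddsupp x) ⟩
  not (isOdd n)                    ≡⟨ sym (isOdd-suc n) ⟩
  isOdd (suc n)                    ∎
  where open ≡-Reasoning

fixParity-oddsupp : ∀ (x : Vec (Fin (suc k)) n) → fixParity (isOdd n) (oddsupp x) ≡ oddsupp x
fixParity-oddsupp x = fixParity-parity _ (oddsupp x) (parity-oddsupp x)

module _ {c ℓ : Level} (B : AbelianGroup c ℓ) where
  open AbelianGroup B renaming (refl to ≈-refl; sym to ≈-sym; trans to ≈-trans)
  open import Algebra.Properties.AbelianGroup B using (⁻¹-anti-homo‿-; ⁻¹-∙-comm; xyx⁻¹≈y)
  open import Algebra.Properties.CommutativeMonoid.Mult commutativeMonoid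
    using (_×_; ×-distrib-+; ×-homo-+; ×-congˡ; ×-congʳ)
  open import Algebra.Properties.CommutativeMonoid.Sum commutativeMonoid using (sum; sum-replicate; sum-replicate-zero)
  open import Relation.Binary.Reasoning.Setoid setoid

  Annihilated : ℕ → Carrier → Set ℓ
  Annihilated t x = (2 ^ t) × x ≈ ε

  annihilated-ε : ∀ t → Annihilated t ε
  annihilated-ε t = ≈-trans (≈-sym (sum-replicate (2 ^ t))) (sum-replicate-zero (2 ^ t))

  annihilated-∙ : ∀ t {x y} → Annihilated t x → Annihilated t y → Annihilated t (x ∙ y)
  annihilated-∙ t {x} {y} ax ay = begin
    (2 ^ t) × (x ∙ y)            ≈⟨ ×-distrib-+ x y (2 ^ t) ⟩
    (2 ^ t) × x ∙ (2 ^ t) × y    ≈⟨ ∙-cong ax ay ⟩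
    ε ∙ ε                        ≈⟨ identityˡ ε ⟩
    ε                            ∎

  annihilated-⁻¹ : ∀ t {x} → Annihilated t x → Annihilated t (x ⁻¹)
  annihilated-⁻¹ t {x} ax = begin
    (2 ^ t) × (x ⁻¹)                 ≈⟨ identityˡ _ ⟨
    ε ∙ (2 ^ t) × (x ⁻¹)             ≈⟨ ∙-congʳ ax ⟨
    (2 ^ t) × x ∙ (2 ^ t) × (x ⁻¹)   ≈⟨ ×-distrib-+ x (x ⁻¹) (2 ^ t) ⟨
    (2 ^ t) × (x ∙ x ⁻¹)           ≈⟨ ×-congʳ (2 ^ t) (inverseʳ x) ⟩
    (2 ^ t) × ε                    ≈⟨ annihilated-ε t ⟩
    ε                              ∎

  annihilated-- : ∀ t {x y} → Annihilated t x → Annihilated t y → Annihilated t (x - y)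
  annihilated-- t ax ay = annihilated-∙ t ax (annihilated-⁻¹ t ay)

  annihilated-double : ∀ t {x} → Annihilated (suc t) x → Annihilated t (x ∙ x)
  annihilated-double t {x} ax = begin
    (2 ^ t) × (x ∙ x)            ≈⟨ ×-distrib-+ x x (2 ^ t) ⟩
    (2 ^ t) × x ∙ (2 ^ t) × x    ≈⟨ ×-homo-+ x (2 ^ t) (2 ^ t) ⟨
    (2 ^ t + 2 ^ t) × x          ≈⟨ ×-congˡ (cong (2 ^ t +_) (sym (+-identityʳ (2 ^ t)))) ⟩
    (2 ^ suc t) × x              ≈⟨ ax ⟩
    ε                            ∎

  if-ε-annihilated : ∀ t b {x} → Annihilated t x → Annihilated t (if b then x else ε)
  if-ε-annihilated t true  ax = ax
  if-ε-annihilated t false _  = annihilated-ε t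

  annihilated-zero : ∀ {x} → Annihilated 0 x → x ≈ ε
  annihilated-zero {x} ax = ≈-trans (≈-sym (identityʳ x)) ax

  if-ε-cong : ∀ b {u v} → u ≈ v → (if b then u else ε) ≈ (if b then v else ε)
  if-ε-cong true  u≈v = u≈v
  if-ε-cong false _   = ≈-refl

  if-ε-∙ : ∀ b u v → (if b then u else ε) ∙ (if b then v else ε) ≈ (if b then u ∙ v else ε)
  if-ε-∙ true  u v = ≈-refl
  if-ε-∙ false u v = identityˡ ε

  sum-select : ∀ {k} (i : Fin k) (d : Fin k → Carrier) → sum (λ a → if does (i ≟ a) then d a else ε) ≈ d i
  sum-select {suc k} zero d = ≈-trans (∙-congˡ (sum-replicate-zero k)) (identityʳ (d zero))
  sum-select {suc k} (suc i) d = ≈-trans (identityˡ _) (sum-select i (d ∘ suc))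

  sumAt : List (Vec (Fin k) n → Carrier) → Vec (Fin k) n → Carrier
  sumAt fs x = foldr (λ g acc → g x ∙ acc) ε fs

  sumAt-++ : ∀ (fs gs : List (Vec (Fin k) n → Carrier)) x → sumAt (fs ++ gs) x ≈ sumAt fs x ∙ sumAt gs x
  sumAt-++ []       gs x = ≈-sym (identityˡ _)
  sumAt-++ (f ∷ fs) gs x = ≈-trans (∙-congˡ (sumAt-++ fs gs x)) (≈-sym (assoc _ _ _))

  decomposable-cong : ∀ {f g : Vec (Fin k) n → Carrier} → (∀ x → f x ≈ g x) →
                      Decomposable B m g → Decomposable B m f
  decomposable-cong f≈g (fs , arities , g≈Σfs) = fs , arities , λ x → ≈-trans (f≈g x) (g≈Σfs x)

  decomposable-mono : ∀ {m′} {f : Vec (Fin k) n → Carrier} → m ≤ m′ →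
                      Decomposable B m f → Decomposable B m′ f
  decomposable-mono m≤m′ (fs , arities , f≈Σfs) =
    fs , All.map (λ (S , ∣S∣≤m , ess) → S , ≤-trans ∣S∣≤m m≤m′ , ess) arities , f≈Σfs

  decomposable-ε : Decomposable B {k} {n} m (λ _ → ε)
  decomposable-ε = [] , [] , λ _ → ≈-refl

  decomposable-∙ : ∀ {f g : Vec (Fin k) n → Carrier} → Decomposable B m f → Decomposable B m g →
                   Decomposable B m (λ x → f x ∙ g x)
  decomposable-∙ (fs , fs-ar , f≈Σfs) (gs , gs-ar , g≈Σgs) =
    fs ++ gs , ++⁺ fs-ar gs-ar , λ x → ≈-trans (∙-cong (f≈Σfs x) (g≈Σgs x)) (≈-sym (sumAt-++ fs gs x))

  decomposable-sum : ∀ {k′} (F : Fin k′ → Vec (Fin k) n → Carrier) → (∀ a → Decomposable B m (F a)) →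
                     Decomposable B m (λ x → sum (λ a → F a x))
  decomposable-sum {k′ = zero}  F dec = decomposable-ε
  decomposable-sum {k′ = suc _} F dec = decomposable-∙ (dec zero) (decomposable-sum (F ∘ suc) (dec ∘ suc))

  decomposable-nullary : (f : Vec (Fin k) 0 → Carrier) → Decomposable B m f
  decomposable-nullary f = f ∷ [] , ([] , z≤n , λ ()) ∷ [] , λ _ → ≈-sym (identityʳ _)

  essArity-tail : (g : Vec (Fin k) n → Carrier) → EssArityAtMost B m g → EssArityAtMost B m (g ∘ tail)
  essArity-tail g (S , ∣S∣≤m , ess) = outside ∷ S , ∣S∣≤m , ess′
    where
    ess′ : ∀ i → Essential B (g ∘ tail) i → i ∈ outside ∷ S
    ess′ zero    (_ ∷ _  , _ , g≉g) = contradiction ≈-refl g≉g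
    ess′ (suc j) (_ ∷ ys , b , g≉g) = there (ess j (ys , b , g≉g))

  sumAt-tail : ∀ (gs : List (Vec (Fin k) n → Carrier)) x → sumAt (map (_∘ tail) gs) x ≈ sumAt gs (tail x)
  sumAt-tail []       x = ≈-refl
  sumAt-tail (g ∷ gs) x = ∙-congˡ (sumAt-tail gs x)

  decomposable-tail : ∀ {g : Vec (Fin k) n → Carrier} → Decomposable B m g → Decomposable B m (g ∘ tail)
  decomposable-tail (gs , arities , g≈Σgs) =
    map (_∘ tail) gs , map⁺ (All.map (essArity-tail _) arities) ,
    λ x → ≈-trans (g≈Σgs (tail x)) (≈-sym (sumAt-tail gs x))

  guard : Fin k → (Vec (Fin k) n → Carrier) → Vec (Fin k) (suc n) → Carrier
  guard a g (y ∷ ys) = if does (y ≟ a) then g ys else ε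

  essArity-guard : ∀ a (g : Vec (Fin k) n → Carrier) →
                   EssArityAtMost B m g → EssArityAtMost B (suc m) (guard a g)
  essArity-guard a g (S , ∣S∣≤m , ess) = inside ∷ S , s≤s ∣S∣≤m , ess′
    where
    ess′ : ∀ i → Essential B (guard a g) i → i ∈ inside ∷ S
    ess′ zero    _                  = here
    ess′ (suc j) (y ∷ ys , b , g≉g) with y ≟ a
    ... | yes _ = there (ess j (ys , b , g≉g))
    ... | no _  = contradiction ≈-refl g≉g

  sumAt-guard : ∀ a (gs : List (Vec (Fin k) n → Carrier)) x → sumAt (map (guard a) gs) x ≈ guard a (sumAt gs) x
  sumAt-guard a []       (y ∷ ys) = reflexive (sym (if-eta (does (y ≟ a))))
  sumAt-guard a (g ∷ gs) (y ∷ ys) = ≈-trans (∙-congˡ (sumAt-guard a gs (y ∷ ys))) (if-ε-∙ (does (y ≟ a)) _ _)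

  guard-vanishes : ∀ a {g : Vec (Fin k) n → Carrier} → (∀ x → g x ≈ ε) → ∀ x → guard a g x ≈ ε
  guard-vanishes a g≈ε (y ∷ ys) =
    ≈-trans (if-ε-cong (does (y ≟ a)) (g≈ε ys)) (reflexive (if-eta (does (y ≟ a))))

  decomposable-guard : ∀ a {g : Vec (Fin k) n → Carrier} →
                       Decomposable B m g → Decomposable B (suc m) (guard a g)
  decomposable-guard a (gs , arities , g≈Σgs) =
    map (guard a) gs , map⁺ (All.map (essArity-guard a _) arities) ,
    λ { x@(y ∷ ys) → ≈-trans (if-ε-cong (does (y ≟ a)) (g≈Σgs ys)) (≈-sym (sumAt-guard a gs x)) }

  DependsOnlyOn : Subset k → (Subset k → Carrier) → Set ℓ
  DependsOnlyOn R ψ = ∀ {b} → b ∉ R → ∀ p → ψ (toggle b p) ≈ ψ p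

  fixParity-dependsOnlyOn : ∀ b (φ : Subset (suc k) → Carrier) →
                            DependsOnlyOn (outside ∷ ⊤) (φ ∘ fixParity b)
  fixParity-dependsOnlyOn b φ {zero}  _   (_ ∷ _) = ≈-refl
  fixParity-dependsOnlyOn b φ {suc i} i∉R _       = contradiction (there ∈⊤) i∉R

  Δ : (Subset k → Carrier) → Fin k → Subset k → Carrier
  Δ ψ a p = ψ (toggle a p) - ψ p

  -- Δ ψ a = Δ₀ ψ a ∙ Δ₁ ψ a (Δ-split): Δ ψ a changes sign when the a-th coordinate is
  -- toggled, so Δ₀ ignores that coordinate and Δ₁ is killed by a smaller power of 2.
  Δ₀ : (Subset k → Carrier) → Fin k → Subset k → Carrier
  Δ₀ ψ a p = Δ ψ a (p [ a ]≔ outside)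

  Δ₁ : (Subset k → Carrier) → Fin k → Subset k → Carrier
  Δ₁ ψ a p = if lookup p a then (Δ₀ ψ a p ∙ Δ₀ ψ a p) ⁻¹ else ε

  x⁻¹≈x∙[x∙x]⁻¹ : ∀ x → x ⁻¹ ≈ x ∙ (x ∙ x) ⁻¹
  x⁻¹≈x∙[x∙x]⁻¹ x = begin
    x ⁻¹                 ≈⟨ identityˡ _ ⟨
    ε ∙ x ⁻¹             ≈⟨ ∙-congʳ (inverseʳ x) ⟨
    x ∙ x ⁻¹ ∙ x ⁻¹      ≈⟨ assoc _ _ _ ⟩
    x ∙ (x ⁻¹ ∙ x ⁻¹)    ≈⟨ ∙-congˡ (⁻¹-∙-comm x x) ⟩
    x ∙ (x ∙ x) ⁻¹       ∎

  module _ (ψ : Subset k → Carrier) where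

    Δ-split : ∀ a p → Δ ψ a p ≈ Δ₀ ψ a p ∙ Δ₁ ψ a p
    Δ-split a p with lookup p a in pₐ
    ... | false = begin
      Δ ψ a p          ≡⟨ cong (Δ ψ a) (updateAt-id-local a p (sym pₐ)) ⟨
      Δ₀ ψ a p         ≈⟨ identityʳ _ ⟨
      Δ₀ ψ a p ∙ ε     ∎
    ... | true = begin
      ψ (toggle a p) - ψ p      ≈⟨ ⁻¹-anti-homo‿- (ψ p) (ψ (toggle a p)) ⟨
      w ⁻¹                      ≈⟨ x⁻¹≈x∙[x∙x]⁻¹ w ⟩
      w ∙ (w ∙ w) ⁻¹            ≡⟨ cong (λ z → z ∙ (z ∙ z) ⁻¹) Δ₀≡w ⟨
      Δ₀ ψ a p ∙ (Δ₀ ψ a p ∙ Δ₀ ψ a p) ⁻¹ ∎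
      where
      w = ψ p - ψ (toggle a p)
      Δ₀≡w : Δ₀ ψ a p ≡ w
      Δ₀≡w = cong₂ (λ q r → ψ q - ψ r)
        (trans (updateAt-updateAt a p) (updateAt-id-local a p (sym pₐ)))
        (updateAt-cong-local a p (sym (cong not pₐ)))

    module _ {R : Subset k} (dep : DependsOnlyOn R ψ) where

      Δ-dependsOnlyOn : ∀ a → DependsOnlyOn R (Δ ψ a)
      Δ-dependsOnlyOn a {b} b∉R p = ∙-cong
        (≈-trans (reflexive (cong ψ (toggle-comm a b p))) (dep b∉R (toggle a p)))
        (⁻¹-cong (dep b∉R p))

      Δ-vanishes : ∀ {a} → a ∉ R → ∀ p → Δ ψ a p ≈ ε
      Δ-vanishes a∉R p = ≈-trans (∙-congʳ (dep a∉R p)) (inverseʳ (ψ p))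

      Δ₀-dependsOnlyOn : ∀ a → DependsOnlyOn (R ─ ⁅ a ⁆) (Δ₀ ψ a)
      Δ₀-dependsOnlyOn a {b} b∉R-a p with b ≟ a
      ... | yes refl = reflexive (cong (Δ ψ b) (updateAt-updateAt b p))
      ... | no b≢a = ≈-trans
        (reflexive (cong (Δ ψ a) (updateAt-commutes a b (b≢a ∘ sym) p)))
        (Δ-dependsOnlyOn a (λ b∈R → b∉R-a (x∈p∧x≢y⇒x∈p-y b∈R b≢a)) (p [ a ]≔ outside))

      Δ₁-dependsOnlyOn : ∀ {a} → a ∈ R → DependsOnlyOn R (Δ₁ ψ a)
      Δ₁-dependsOnlyOn {a} a∈R {b} b∉R p = begin
        Δ₁ ψ a (toggle b p)             ≡⟨ cong (λ c → if c then w² else ε) (lookup∘updateAt′ a b a≢b p) ⟩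
        (if lookup p a then w² else ε)  ≈⟨ if-ε-cong (lookup p a) (⁻¹-cong (∙-cong w-inv w-inv)) ⟩
        Δ₁ ψ a p                        ∎
        where
        a≢b : a ≢ b
        a≢b refl = b∉R a∈R
        w-inv : Δ₀ ψ a (toggle b p) ≈ Δ₀ ψ a p
        w-inv = Δ₀-dependsOnlyOn a (b∉R ∘ p─q⊆p R ⁅ a ⁆) p
        w² = (Δ₀ ψ a (toggle b p) ∙ Δ₀ ψ a (toggle b p)) ⁻¹

    Δ₀-annihilated : ∀ t → (∀ p → Annihilated t (ψ p)) → ∀ a p → Annihilated t (Δ₀ ψ a p)
    Δ₀-annihilated t ann a p = annihilated-- t (ann _) (ann _)

    Δ₁-annihilated : ∀ t → (∀ p → Annihilated (suc t) (ψ p)) → ∀ a p → Annihilated t (Δ₁ ψ a p)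
    Δ₁-annihilated t ann a p = if-ε-annihilated t (lookup p a)
      (annihilated-⁻¹ t (annihilated-double t (Δ₀-annihilated (suc t) ann a p)))

  arity-Δ₀ : ∀ {r′ r} t → r′ < r → r′ + suc t ∸ 1 ≤ r + t ∸ 1
  arity-Δ₀ {r′} {suc r} t (s≤s r′≤r) = ≤-trans (≤-reflexive (cong (_∸ 1) (+-suc r′ t))) (+-monoˡ-≤ t r′≤r)

  arity-guard : ∀ {r′ r} t → r′ < r → suc (r + t ∸ 1) ≡ r + suc t ∸ 1
  arity-guard {r = suc r} t _ = sym (+-suc r t)

  oddsupp-decomposable : ∀ n t {R : Subset k} {ψ : Subset k → Carrier} →
    DependsOnlyOn R ψ → (∀ p → Annihilated t (ψ p)) →
    Decomposable B (∣ R ∣ + t ∸ 1) (λ (x : Vec (Fin k) n) → ψ (oddsupp x))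
  oddsupp-decomposable zero    t dep ann = decomposable-nullary _
  oddsupp-decomposable (suc n) t {R} {ψ} dep ann =
    decomposable-cong expand
      (decomposable-∙ (decomposable-tail (oddsupp-decomposable n t dep ann)) (decomposable-sum _ derivative))
    where
    expand : ∀ x → ψ (oddsupp x) ≈ ψ (oddsupp (tail x)) ∙ sum (λ a → guard a (Δ ψ a ∘ oddsupp) x)
    expand (y ∷ x) = begin
      ψ (oddsupp (y ∷ x))                 ≡⟨ cong ψ (oddsupp-∷ y x) ⟩
      ψ (toggle y (oddsupp x))            ≈⟨ xyx⁻¹≈y (ψ (oddsupp x)) _ ⟨
      ψ (oddsupp x) ∙ ψ (toggle y (oddsupp x)) ∙ ψ (oddsupp x) ⁻¹ ≈⟨ assoc _ _ _ ⟩
      ψ (oddsupp x) ∙ Δ ψ y (oddsupp x)  ≈⟨ ∙-congˡ (sum-select y _) ⟨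
      ψ (oddsupp x) ∙ sum (λ a → guard a (Δ ψ a ∘ oddsupp) (y ∷ x)) ∎

    derivative-∈ : ∀ t → (∀ p → Annihilated t (ψ p)) → ∀ {a} → a ∈ R →
                   Decomposable B (∣ R ∣ + t ∸ 1) (guard a (Δ ψ a ∘ oddsupp))
    derivative-∈ zero ann {a} _ = decomposable-cong
      (guard-vanishes a λ _ → annihilated-zero (annihilated-- 0 (ann _) (ann _))) decomposable-ε
    derivative-∈ (suc t) ann {a} a∈R =
      decomposable-mono (≤-reflexive (arity-guard t ∣R-a∣<∣R∣)) (decomposable-guard a
        (decomposable-cong (λ x → Δ-split ψ a (oddsupp x)) (decomposable-∙
          (decomposable-mono (arity-Δ₀ t ∣R-a∣<∣R∣)
            (oddsupp-decomposable n (suc t) (Δ₀-dependsOnlyOn ψ dep a) (Δ₀-annihilated ψ (suc t) ann a)))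
          (oddsupp-decomposable n t (Δ₁-dependsOnlyOn ψ dep a∈R) (Δ₁-annihilated ψ t ann a)))))
      where
      ∣R-a∣<∣R∣ : ∣ R ─ ⁅ a ⁆ ∣ < ∣ R ∣
      ∣R-a∣<∣R∣ = x∈p⇒∣p-x∣<∣p∣ a∈R

    derivative : ∀ a → Decomposable B (∣ R ∣ + t ∸ 1) (guard a (Δ ψ a ∘ oddsupp))
    derivative a with a ∈? R
    ... | no a∉R  = decomposable-cong (guard-vanishes a (Δ-vanishes ψ dep a∉R ∘ oddsupp)) decomposable-ε
    ... | yes a∈R = derivative-∈ t ann a∈R

theorem3p4 : ∀ {c ℓ : Level} (k : ℕ) → 2 ≤ k → (e : ℕ) → 1 ≤ e →
    (B : AbelianGroup c ℓ) → HasExponent B (2 ^ e) →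
    (n : ℕ) → 1 ≤ n →
    (f : Vec (Fin k) n → AbelianGroup.Carrier B) →
    DeterminedByOddsupp B f →
    Decomposable B (k + e ∸ 2) f
theorem3p4 (suc (suc k)) (s≤s (s≤s z≤n)) e _ B (_ , 2^e-annihilates , _) n _ f (φ , f≈φ∘oddsupp) =
  decomposable-cong B f≈ψ∘oddsupp
    (decomposable-mono B (≤-reflexive (cong (λ r → r + e ∸ 1) (∣⊤∣≡n (suc k))))
      (oddsupp-decomposable B n e (fixParity-dependsOnlyOn B (isOdd n) φ) (λ _ → 2^e-annihilates _)))
  where
  open AbelianGroup B using (_≈_) renaming (trans to ≈-trans; reflexive to ≈-reflexive)
  f≈ψ∘oddsupp : ∀ x → f x ≈ φ (fixParity (isOdd n) (oddsupp x))
  f≈ψ∘oddsupp x = ≈-trans (f≈φ∘oddsupp x) (≈-reflexive (cong φ (sym (fixParity-oddsupp x))))
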